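{- Let $A\in\mathbb{Z}^{m\times n}$ with $\operatorname{rank}(A)=m$, $\bm{b}\in\mathbb{Z}^m$, $\bm{c}\in\mathbb{Z}^n$, such that the integer linear program $\max\{\bm{c}^\intercal\bm{x}\mid A\bm{x}=\bm{b},\ \bm{x}\in\mathbb{Z}^n_{\geq0}\}$ is feasible and has an optimal solution, and let $A_{\max}\coloneqq\max_i\|A_i\|_1$ be the largest $1$-norm of a column of $A$. Then there is an optimal solution $\bm{v}$ with $s=|\operatorname{supp}(\bm{v})|$ such that $$s/m\leq 1+\log(e)+\log\bigl(1+(s/m)\cdot A_{\max}\bigr).$$
   Context: $\log$ denotes the base-2 logarithm and $e$ Euler's number. $\operatorname{supp}(\bm{v})$ is the set of indices of non-zero entries of $\bm{v}$. -}

module Defs where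

open import Data.Nat as ℕ using (ℕ; zero; suc; _^_; _!; _⊔_)
open import Data.Nat.Properties using (_!≢0)
open import Data.Integer as ℤ using (ℤ; +_; ∣_∣)
open import Data.Rational as ℚ using (ℚ; 0ℚ)
open import Data.Fin using (Fin; zero; suc)
open import Data.Product using (∃-syntax; _×_)
open import Relation.Binary.PropositionalEquality using (_≡_)

sumℤ : ∀ {n} → (Fin n → ℤ) → ℤ
sumℤ {zero}  f = + 0
sumℤ {suc n} f = f zero ℤ.+ sumℤ (λ i → f (suc i))

maxℕ : ∀ {n} → (Fin n → ℕ) → ℕ
maxℕ {zero}  f = 0
maxℕ {suc n} f = f zero ⊔ maxℕ (λ i → f (suc i))

suppSize : ∀ {n} → (Fin n → ℕ) → ℕ
suppSize {zero}  v = 0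
suppSize {suc n} v with v zero
... | zero  = suppSize (λ i → v (suc i))
... | suc _ = suc (suppSize (λ i → v (suc i)))

Matrix : ℕ → ℕ → Set
Matrix m n = Fin m → Fin n → ℤ

mulVec : ∀ {m n} → Matrix m n → (Fin n → ℕ) → Fin m → ℤ
mulVec A x j = sumℤ (λ i → A j i ℤ.* + x i)

dot : ∀ {n} → (Fin n → ℤ) → (Fin n → ℕ) → ℤ
dot c x = sumℤ (λ i → c i ℤ.* + x i)

-- rank(A) = m : the m rows of A are linearly independent
-- (over ℤ, equivalently over ℚ by clearing denominators)
FullRowRank : ∀ {m n} → Matrix m n → Set
FullRowRank {m} {n} A =
  (y : Fin m → ℤ) → (∀ i → sumℤ (λ j → y j ℤ.* A j i) ≡ + 0) → ∀ j → y j ≡ + 0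

Feasible : ∀ {m n} → Matrix m n → (Fin m → ℤ) → (Fin n → ℕ) → Set
Feasible A b x = ∀ j → mulVec A x j ≡ b j

Optimal : ∀ {m n} → Matrix m n → (Fin m → ℤ) → (Fin n → ℤ) → (Fin n → ℕ) → Set
Optimal A b c x = Feasible A b x × (∀ y → Feasible A b y → dot c y ℤ.≤ dot c x)

Amax : ∀ {m n} → Matrix m n → ℕ
Amax A = maxℕ (λ i → ∣ sumℤ (λ j → + ∣ A j i ∣) ∣)

expSum : ℕ → ℕ → ℚ
expSum x zero    = 0ℚ
expSum x (suc N) = expSum x N ℚ.+ ((+ (x ^ N)) ℚ./ (N !)) {{N !≢0}}

-- P ≤ Q · e^x  (for Q ≥ 0), with e^x = sup_N expSum x N :
-- every rational below P is exceeded by some Q · expSum x N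
_≤_·exp_ : ℚ → ℚ → ℕ → Set
P ≤ Q ·exp x = (r : ℚ) → r ℚ.< P → ∃[ N ] r ℚ.< Q ℚ.* expSum x N

-- The inequality  s/m ≤ 1 + log₂ e + log₂ (1 + (s/m)·a)  for m ≥ 1,
-- equivalently (monotone transformations: exponentiate base 2, raise to
-- the m-th power, multiply by m^m)
--     2^s · m^m ≤ (2 (m + s·a))^m · e^m .
SupportBound : ℕ → ℕ → ℕ → Set
SupportBound m s a =
  (+ (2 ^ s ℕ.* m ^ m) ℚ./ 1) ≤ (+ ((2 ℕ.* (m ℕ.+ s ℕ.* a)) ^ m) ℚ./ 1) ·exp m

{-# OPTIONS --safe #-}

-- Let v be optimal with s = |supp v|. The 2^s vectors y ∈ {0,1}ⁿ with y ≤ v satisfy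
-- ‖A y‖₁ ≤ s·A_max, and the ℓ₁-ball of radius R in ℤ^m has at most 2^m (R + m)^m / m!
-- lattice points. If 2^s exceeds this count, two of them, y ≠ z, have A y = A z. Then
-- v + y − z and v − y + z are both feasible, so c·y = c·z and v + y − z is optimal again;
-- repeating this step, which never enlarges the support, eventually empties a coordinate
-- of supp v. Hence an optimal solution of minimal support satisfies
-- 2^s · m! ≤ (2 (m + s·A_max))^m, and e^m ≥ m^m / m! turns this into the stated bound.

module Submission where

open import Defs
open import Data.Nat as ℕ
  using (ℕ; zero; suc; NonZero; _+_; _*_; _∸_; _^_; _!; _≤_; _<_; _≤?_; _<?_; z≤n; s≤s)
open import Data.Nat.Properties
open import Data.Nat.Induction using (<-wellFounded)
open import Data.Nat.Tactic.RingSolver using (solve-∀)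
open import Data.Integer as ℤ using (ℤ; +_; -[1+_]; ∣_∣)
import Data.Integer.Properties as ℤ
open import Algebra.Properties.AbelianGroup ℤ.+-0-abelianGroup using (∙-cancelʳ; //-rightDividesʳ)
open import Algebra.Properties.CommutativeSemigroup ℤ.+-commutativeSemigroup using (interchange)
open import Data.Rational as ℚ using (NonNegative; toℚᵘ)
import Data.Rational.Properties as ℚ
open import Data.Rational.Unnormalised as ℚᵘ using (mkℚᵘ; *≤*)
import Data.Rational.Unnormalised.Properties as ℚᵘ
open import Data.Fin as Fin using (Fin; zero; suc)
import Data.Fin.Properties as Fin
open import Data.Vec as Vec using (Vec; []; _∷_; tabulate; _[_]%=_)
open import Data.Vec.Properties using (lookup∘tabulate)
import Data.Vec.Functional as VF
open import Data.List as List using (List; []; _∷_; _++_; [_]; length; concatMap)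
open import Data.List.Properties using (length-++; length-map)
open import Data.List.Membership.Propositional using (_∈_)
open import Data.List.Membership.Propositional.Properties
  using (∈-map⁺; ∈-++⁺ˡ; ∈-++⁺ʳ; ∈-concat⁺′; ∈-lookup)
open import Data.List.Relation.Unary.Any as Any using (here)
open import Data.List.Relation.Unary.Any.Properties using (lookup-index)
open import Data.List.Relation.Unary.All as All using (All; []; _∷_)
import Data.List.Relation.Unary.All.Properties as AllP
open import Data.List.Relation.Unary.AllPairs as AllPairs using (AllPairs; []; _∷_)
import Data.List.Relation.Unary.AllPairs.Properties as AllPairsP
open import Data.Product using (∃-syntax; ∃₂; _×_; _,_; proj₁; proj₂)
open import Data.Sum using (_⊎_; inj₁; inj₂)
open import Function using (_∘_; _on_; case_of_)
open import Induction.WellFounded using (Acc; acc)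
import Relation.Binary.Construct.On as On
open import Relation.Nullary using (¬_; yes; no; contradiction)
open import Relation.Binary.PropositionalEquality
  using (_≡_; _≢_; _≗_; refl; sym; trans; cong; cong₂; subst; subst₂; module ≡-Reasoning)

private variable
  m n : ℕ

-- e^x ≥ x^N / N!

expSum-nonNeg : ∀ x N → NonNegative (expSum x N)
expSum-nonNeg x zero    = _
expSum-nonNeg x (suc N) = ℚ.nonNeg+nonNeg⇒nonNeg (expSum x N) {{expSum-nonNeg x N}}
  ((+ (x ^ N) ℚ./ N !) {{N !≢0}}) {{ℚ.normalize-nonNeg (x ^ N) (N !) {{N !≢0}}}}

x^N/N!≤expSum : ∀ x N → (+ (x ^ N) ℚ./ N !) {{N !≢0}} ℚ.≤ expSum x (suc N)
x^N/N!≤expSum x N = begin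
  t                ≡⟨ ℚ.+-identityˡ t ⟨
  ℚ.0ℚ ℚ.+ t       ≤⟨ ℚ.+-monoˡ-≤ t (ℚ.nonNegative⁻¹ (expSum x N) {{expSum-nonNeg x N}}) ⟩
  expSum x N ℚ.+ t ∎
  where
  open ℚ.≤-Reasoning
  t = (+ (x ^ N) ℚ./ N !) {{N !≢0}}

toℚᵘ-/ : ∀ i d .{{_ : NonZero d}} → toℚᵘ (i ℚ./ d) ℚᵘ.≃ (i ℚᵘ./ d)
toℚᵘ-/ i (suc d) = ℚ.toℚᵘ-fromℚᵘ (mkℚᵘ i d)

p*d≤q*a⇒p≤q*a/d : ∀ p q a d .{{_ : NonZero d}} → p * d ≤ q * a →
                  + p ℚ./ 1 ℚ.≤ (+ q ℚ./ 1) ℚ.* (+ a ℚ./ d)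
p*d≤q*a⇒p≤q*a/d p q a d@(suc _) pd≤qa = ℚ.toℚᵘ-cancel-≤ chain
  where
  cross : + p ℤ.* + (1 * d) ℤ.≤ (+ q ℤ.* + a) ℤ.* + 1
  cross = begin
    + p ℤ.* + (1 * d)     ≡⟨ cong (λ e → + p ℤ.* + e) (*-identityˡ d) ⟩
    + p ℤ.* + d           ≡⟨ ℤ.pos-* p d ⟨
    + (p * d)             ≤⟨ ℤ.+≤+ pd≤qa ⟩
    + (q * a)             ≡⟨ ℤ.pos-* q a ⟩
    + q ℤ.* + a           ≡⟨ ℤ.*-identityʳ _ ⟨
    (+ q ℤ.* + a) ℤ.* + 1 ∎
    where open ℤ.≤-Reasoning
  chain : toℚᵘ (+ p ℚ./ 1) ℚᵘ.≤ toℚᵘ ((+ q ℚ./ 1) ℚ.* (+ a ℚ./ d))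
  chain = begin
    toℚᵘ (+ p ℚ./ 1)                       ≃⟨ toℚᵘ-/ (+ p) 1 ⟩
    + p ℚᵘ./ 1                             ≤⟨ *≤* cross ⟩
    (+ q ℚᵘ./ 1) ℚᵘ.* (+ a ℚᵘ./ d)         ≃⟨ ℚᵘ.*-cong (toℚᵘ-/ (+ q) 1) (toℚᵘ-/ (+ a) d) ⟨
    toℚᵘ (+ q ℚ./ 1) ℚᵘ.* toℚᵘ (+ a ℚ./ d) ≃⟨ ℚ.toℚᵘ-homo-* (+ q ℚ./ 1) (+ a ℚ./ d) ⟨
    toℚᵘ ((+ q ℚ./ 1) ℚ.* (+ a ℚ./ d))     ∎
    where open ℚᵘ.≤-Reasoning

≤·exp-intro : ∀ P Q x N → P * N ! ≤ Q * x ^ N → (+ P ℚ./ 1) ≤ (+ Q ℚ./ 1) ·exp x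
≤·exp-intro P Q x N PN!≤Qx^N r r<P = suc N , ℚ.<-≤-trans r<P (begin
  + P ℚ./ 1                                 ≤⟨ p*d≤q*a⇒p≤q*a/d P Q (x ^ N) (N !) {{N !≢0}} PN!≤Qx^N ⟩
  (+ Q ℚ./ 1) ℚ.* (+ (x ^ N) ℚ./ N !) {{N !≢0}}
    ≤⟨ ℚ.*-monoˡ-≤-nonNeg (+ Q ℚ./ 1) {{ℚ.normalize-nonNeg Q 1}} (x^N/N!≤expSum x N) ⟩
  (+ Q ℚ./ 1) ℚ.* expSum x (suc N)          ∎)
  where open ℚ.≤-Reasoning

SupportBound-intro : ∀ m s a → 2 ^ s * m ! ≤ (2 * (m + s * a)) ^ m → SupportBound m s a
SupportBound-intro m s a 2^s*m!≤Q = ≤·exp-intro (2 ^ s * m ^ m) Q m m (begin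
  2 ^ s * m ^ m * m ! ≡⟨ rearrange (2 ^ s) (m ^ m) (m !) ⟩
  2 ^ s * m ! * m ^ m ≤⟨ *-monoˡ-≤ (m ^ m) 2^s*m!≤Q ⟩
  Q * m ^ m           ∎)
  where
  open ≤-Reasoning
  Q = (2 * (m + s * a)) ^ m
  rearrange : ∀ x y z → x * y * z ≡ x * z * y
  rearrange = solve-∀

-- Lattice points of the ℓ₁-ball

[1+m]*x^m+x^[1+m]≤[1+x]^[1+m] : ∀ m x → suc m * x ^ m + x ^ suc m ≤ suc x ^ suc m
[1+m]*x^m+x^[1+m]≤[1+x]^[1+m] zero    x = ≤-refl
[1+m]*x^m+x^[1+m]≤[1+x]^[1+m] (suc m) x = begin
  suc (suc m) * (x * x ^ m) + x * (x * x ^ m)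
    ≤⟨ m≤n+m _ (suc m * x ^ m) ⟩
  suc m * x ^ m + (suc (suc m) * (x * x ^ m) + x * (x * x ^ m))
    ≡⟨ factor m x (x ^ m) ⟩
  suc x * (suc m * x ^ m + x * x ^ m)
    ≤⟨ *-monoʳ-≤ (suc x) ([1+m]*x^m+x^[1+m]≤[1+x]^[1+m] m x) ⟩
  suc x * suc x ^ suc m ∎
  where
  open ≤-Reasoning
  factor : ∀ m x y → suc m * y + (suc (suc m) * (x * y) + x * (x * y)) ≡ suc x * (suc m * y + x * y)
  factor = solve-∀

^-distribʳ-* : ∀ a b m → (a * b) ^ m ≡ a ^ m * b ^ m
^-distribʳ-* a b zero    = refl
^-distribʳ-* a b (suc m) = trans (cong ((a * b) *_) (^-distribʳ-* a b m))
                                 ([m*n]*[o*p]≡[m*o]*[n*p] a b (a ^ m) (b ^ m))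

length-map-++-map : ∀ {A B C : Set} (f : A → C) (g : B → C) xs ys →
                    length (List.map f xs ++ List.map g ys) ≡ length xs + length ys
length-map-++-map f g xs ys =
  trans (length-++ (List.map f xs)) (cong₂ _+_ (length-map f xs) (length-map g ys))

length-concatMap-const : ∀ {A B : Set} (f : A → List B) {L} → (∀ x → length (f x) ≡ L) →
                         ∀ xs → length (concatMap f xs) ≡ length xs * L
length-concatMap-const f |f|≡L []       = refl
length-concatMap-const f |f|≡L (x ∷ xs) =
  trans (length-++ (f x)) (cong₂ _+_ (|f|≡L x) (length-concatMap-const f |f|≡L xs))

simplex : ℕ → (m : ℕ) → List (Vec ℕ m)
simplex R       zero    = [ [] ]
simplex zero    (suc m) = List.map (0 ∷_) (simplex zero m)
simplex (suc R) (suc m) =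
  List.map (0 ∷_) (simplex (suc R) m) ++ List.map (_[ zero ]%= suc) (simplex R (suc m))

∈-simplex : ∀ R (u : Vec ℕ m) → Vec.sum u ≤ R → u ∈ simplex R m
∈-simplex R       []          _  = here refl
∈-simplex zero    (zero ∷ u)  Σu≤0 = ∈-map⁺ (0 ∷_) (∈-simplex zero u Σu≤0)
∈-simplex (suc R) (zero ∷ u)  Σu≤R = ∈-++⁺ˡ (∈-map⁺ (0 ∷_) (∈-simplex (suc R) u Σu≤R))
∈-simplex (suc R) (suc k ∷ u) (s≤s Σu≤R) =
  ∈-++⁺ʳ _ (∈-map⁺ (_[ zero ]%= suc) (∈-simplex R (k ∷ u) Σu≤R))

-- Pascal's rule for the count, against the first two binomial terms of (R + m + 1)^(m + 1).
simplex-count : ∀ R m → m ! * length (simplex R m) ≤ (R + m) ^ m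
simplex-count R       zero    = ≤-refl
simplex-count zero    (suc m) = begin
  suc m ! * length (List.map (0 ∷_) (simplex 0 m))
    ≡⟨ cong (suc m ! *_) (length-map (0 ∷_) (simplex 0 m)) ⟩
  suc m * m ! * length (simplex 0 m)                ≡⟨ *-assoc (suc m) (m !) _ ⟩
  suc m * (m ! * length (simplex 0 m))              ≤⟨ *-monoʳ-≤ (suc m) (simplex-count 0 m) ⟩
  suc m * m ^ m                                     ≤⟨ m≤m+n _ _ ⟩
  suc m * m ^ m + m ^ suc m                         ≤⟨ [1+m]*x^m+x^[1+m]≤[1+x]^[1+m] m m ⟩
  suc m ^ suc m                                     ∎
  where open ≤-Reasoning
simplex-count (suc R) (suc m) = begin
  suc m ! * length (List.map (0 ∷_) S₁ ++ List.map (_[ zero ]%= suc) S₂)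
    ≡⟨ cong (suc m ! *_) (length-map-++-map (0 ∷_) (_[ zero ]%= suc) S₁ S₂) ⟩
  suc m * m ! * (length S₁ + length S₂)
    ≡⟨ distribute (suc m) (m !) (length S₁) (length S₂) ⟩
  suc m * (m ! * length S₁) + suc m ! * length S₂
    ≤⟨ +-mono-≤ (*-monoʳ-≤ (suc m) (simplex-count (suc R) m)) (simplex-count R (suc m)) ⟩
  suc m * (suc R + m) ^ m + (R + suc m) ^ suc m
    ≡⟨ cong (λ k → suc m * (suc R + m) ^ m + k ^ suc m) (+-suc R m) ⟩
  suc m * (suc R + m) ^ m + (suc R + m) ^ suc m
    ≤⟨ [1+m]*x^m+x^[1+m]≤[1+x]^[1+m] m (suc R + m) ⟩
  suc (suc R + m) ^ suc m
    ≡⟨ cong (_^ suc m) (+-suc (suc R) m) ⟨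
  (suc R + suc m) ^ suc m ∎
  where
  open ≤-Reasoning
  S₁ = simplex (suc R) m
  S₂ = simplex R (suc m)
  distribute : ∀ k f a b → k * f * (a + b) ≡ k * (f * a) + k * f * b
  distribute = solve-∀

signings : Vec ℕ m → List (Vec ℤ m)
signings []      = [ [] ]
signings (k ∷ u) = List.map (+ k ∷_) (signings u) ++ List.map (ℤ.- (+ k) ∷_) (signings u)

length-signings : ∀ (u : Vec ℕ m) → length (signings u) ≡ 2 ^ m
length-signings []      = refl
length-signings (k ∷ u) = trans (length-map-++-map _ _ (signings u) (signings u))
  (cong₂ _+_ (length-signings u) (trans (length-signings u) (sym (+-identityʳ _))))

∈-signings : ∀ (p : Vec ℤ m) → p ∈ signings (Vec.map ∣_∣ p)
∈-signings []             = here refl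
∈-signings (+ k ∷ p)      = ∈-++⁺ˡ (∈-map⁺ (+ k ∷_) (∈-signings p))
∈-signings (-[1+ k ] ∷ p) = ∈-++⁺ʳ _ (∈-map⁺ (-[1+ k ] ∷_) (∈-signings p))

∥_∥₁ : Vec ℤ m → ℕ
∥ p ∥₁ = Vec.sum (Vec.map ∣_∣ p)

-- A point with zero coordinates occurs several times; only membership and length matter.
ℓ₁-ball : ℕ → (m : ℕ) → List (Vec ℤ m)
ℓ₁-ball R m = concatMap signings (simplex R m)

∈-ℓ₁-ball : ∀ {R} (p : Vec ℤ m) → ∥ p ∥₁ ≤ R → p ∈ ℓ₁-ball R m
∈-ℓ₁-ball {R = R} p ∥p∥≤R =
  ∈-concat⁺′ (∈-signings p) (∈-map⁺ signings (∈-simplex R (Vec.map ∣_∣ p) ∥p∥≤R))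

ℓ₁-ball-count : ∀ R m → m ! * length (ℓ₁-ball R m) ≤ (2 * (m + R)) ^ m
ℓ₁-ball-count R m = begin
  m ! * length (ℓ₁-ball R m)
    ≡⟨ cong (m ! *_) (length-concatMap-const signings length-signings (simplex R m)) ⟩
  m ! * (length (simplex R m) * 2 ^ m) ≡⟨ *-assoc (m !) _ _ ⟨
  m ! * length (simplex R m) * 2 ^ m   ≤⟨ *-monoˡ-≤ (2 ^ m) (simplex-count R m) ⟩
  (R + m) ^ m * 2 ^ m                  ≡⟨ *-comm ((R + m) ^ m) (2 ^ m) ⟩
  2 ^ m * (R + m) ^ m                  ≡⟨ ^-distribʳ-* 2 (R + m) m ⟨
  (2 * (R + m)) ^ m                    ≡⟨ cong (λ k → (2 * k) ^ m) (+-comm R m) ⟩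
  (2 * (m + R)) ^ m                    ∎
  where open ≤-Reasoning

∥tabulate-+∥₁ : ∀ (f g : Fin m → ℤ) →
                ∥ tabulate (λ j → f j ℤ.+ g j) ∥₁ ≤ ∥ tabulate f ∥₁ + ∥ tabulate g ∥₁
∥tabulate-+∥₁ {zero}  f g = z≤n
∥tabulate-+∥₁ {suc m} f g = begin
  ∣ f zero ℤ.+ g zero ∣ + ∥ tabulate (λ j → f (suc j) ℤ.+ g (suc j)) ∥₁
    ≤⟨ +-mono-≤ (ℤ.∣i+j∣≤∣i∣+∣j∣ (f zero) (g zero)) (∥tabulate-+∥₁ (f ∘ suc) (g ∘ suc)) ⟩
  (∣ f zero ∣ + ∣ g zero ∣) + (∥ tabulate (f ∘ suc) ∥₁ + ∥ tabulate (g ∘ suc) ∥₁)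
    ≡⟨ +-interchange ∣ f zero ∣ ∣ g zero ∣ _ _ ⟩
  (∣ f zero ∣ + ∥ tabulate (f ∘ suc) ∥₁) + (∣ g zero ∣ + ∥ tabulate (g ∘ suc) ∥₁) ∎
  where
  open ≤-Reasoning
  +-interchange : ∀ a b c d → (a + b) + (c + d) ≡ (a + c) + (b + d)
  +-interchange = solve-∀

∥tabulate-*∥₁ : ∀ (f : Fin m → ℤ) k → ∥ tabulate (λ j → f j ℤ.* + k) ∥₁ ≡ ∥ tabulate f ∥₁ * k
∥tabulate-*∥₁ {zero}  f k = refl
∥tabulate-*∥₁ {suc m} f k =
  trans (cong₂ _+_ (ℤ.abs-* (f zero) (+ k)) (∥tabulate-*∥₁ (f ∘ suc) k))
        (sym (*-distribʳ-+ k ∣ f zero ∣ _))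

∥tabulate-0∥₁ : ∀ m → ∥ tabulate {n = m} (λ _ → + 0) ∥₁ ≡ 0
∥tabulate-0∥₁ zero    = refl
∥tabulate-0∥₁ (suc m) = ∥tabulate-0∥₁ m

sumℤ-∣∣ : ∀ (g : Fin m → ℤ) → sumℤ (λ j → + ∣ g j ∣) ≡ + ∥ tabulate g ∥₁
sumℤ-∣∣ {zero}  g = refl
sumℤ-∣∣ {suc m} g =
  trans (cong (λ s → + ∣ g zero ∣ ℤ.+ s) (sumℤ-∣∣ (g ∘ suc))) (sym (ℤ.pos-+ ∣ g zero ∣ _))

≤maxℕ : ∀ (f : Fin n → ℕ) i → f i ≤ maxℕ f
≤maxℕ f zero    = m≤m⊔n (f zero) _
≤maxℕ f (suc i) = m≤n⇒m≤o⊔n (f zero) (≤maxℕ (f ∘ suc) i)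

column : Matrix m n → Fin n → Vec ℤ m
column A i = tabulate (λ j → A j i)

∥column∥₁≤Amax : ∀ (A : Matrix m n) i → ∥ column A i ∥₁ ≤ Amax A
∥column∥₁≤Amax A i = subst (_≤ Amax A) (cong ∣_∣ (sumℤ-∣∣ (λ j → A j i))) (≤maxℕ _ i)

∥A*y∥₁≤Σy*Amax : ∀ (A : Matrix m n) y →
                 ∥ tabulate (mulVec A y) ∥₁ ≤ Vec.sum (tabulate y) * Amax A
∥A*y∥₁≤Σy*Amax {m} {zero}  A y = ≤-reflexive (∥tabulate-0∥₁ m)
∥A*y∥₁≤Σy*Amax {m} {suc n} A y = begin
  ∥ tabulate (mulVec A y) ∥₁
    ≤⟨ ∥tabulate-+∥₁ (λ j → A j zero ℤ.* + y zero) (mulVec A′ (y ∘ suc)) ⟩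
  ∥ tabulate (λ j → A j zero ℤ.* + y zero) ∥₁ + ∥ tabulate (mulVec A′ (y ∘ suc)) ∥₁
    ≤⟨ +-mono-≤ (≤-reflexive (∥tabulate-*∥₁ (λ j → A j zero) (y zero)))
                (∥A*y∥₁≤Σy*Amax A′ (y ∘ suc)) ⟩
  ∥ column A zero ∥₁ * y zero + Σy′ * Amax A′
    ≤⟨ +-mono-≤ (*-monoˡ-≤ (y zero) (∥column∥₁≤Amax A zero))
                (*-monoʳ-≤ Σy′ (m≤n⊔m _ (Amax A′))) ⟩
  Amax A * y zero + Σy′ * Amax A
    ≡⟨ cong (_+ Σy′ * Amax A) (*-comm (Amax A) (y zero)) ⟩
  y zero * Amax A + Σy′ * Amax A
    ≡⟨ *-distribʳ-+ (Amax A) (y zero) Σy′ ⟨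
  (y zero + Σy′) * Amax A ∎
  where
  open ≤-Reasoning
  A′ : Matrix m n
  A′ j i = A j (suc i)
  Σy′ = Vec.sum (tabulate (y ∘ suc))

-- Supports and 0/1 vectors below v

_⊆ˢ_ : (w v : Fin n → ℕ) → Set
w ⊆ˢ v = ∀ i → v i ≡ 0 → w i ≡ 0

suppSize-mono : ∀ {w v : Fin n → ℕ} → w ⊆ˢ v → suppSize w ≤ suppSize v
suppSize-mono {zero}              w⊆v = z≤n
suppSize-mono {suc n} {w} {v} w⊆v with w zero in w₀ | v zero in v₀
... | zero  | zero  = suppSize-mono (w⊆v ∘ suc)
... | zero  | suc _ = m≤n⇒m≤1+n (suppSize-mono (w⊆v ∘ suc))
... | suc _ | zero  with () ← trans (sym w₀) (w⊆v zero v₀)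
... | suc _ | suc _ = s≤s (suppSize-mono (w⊆v ∘ suc))

suppSize-mono-< : ∀ {w v : Fin n → ℕ} → w ⊆ˢ v →
                  ∀ i → w i ≡ 0 → v i ≢ 0 → suppSize w < suppSize v
suppSize-mono-< {suc n} {w} {v} w⊆v zero w₀≡0 v₀≢0 with w zero | v zero
... | _     | zero  = contradiction refl v₀≢0
... | zero  | suc _ = s≤s (suppSize-mono (w⊆v ∘ suc))
suppSize-mono-< {suc n} {w} {v} w⊆v (suc i) wᵢ≡0 vᵢ≢0 with w zero in w₀ | v zero in v₀
... | zero  | zero  = suppSize-mono-< (w⊆v ∘ suc) i wᵢ≡0 vᵢ≢0
... | zero  | suc _ = m≤n⇒m≤1+n (suppSize-mono-< (w⊆v ∘ suc) i wᵢ≡0 vᵢ≢0)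
... | suc _ | zero  with () ← trans (sym w₀) (w⊆v zero v₀)
... | suc _ | suc _ = s≤s (suppSize-mono-< (w⊆v ∘ suc) i wᵢ≡0 vᵢ≢0)

⊆ˢ-antisym-suppSize : ∀ {w v : Fin n → ℕ} → w ⊆ˢ v → ¬ suppSize w < suppSize v → v ⊆ˢ w
⊆ˢ-antisym-suppSize {v = v} w⊆v w≮v i wᵢ≡0 with v i in vᵢ
... | zero  = refl
... | suc _ = contradiction (suppSize-mono-< w⊆v i wᵢ≡0 vᵢ≢0) w≮v
  where vᵢ≢0 = λ vᵢ≡0 → 1+n≢0 (trans (sym vᵢ) vᵢ≡0)

SubIndicator : (v y : Fin n → ℕ) → Set
SubIndicator v y = ∀ i → y i ≤ 1 × y i ≤ v i

Apart : (y z : Fin n → ℕ) → Set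
Apart y z = ∃[ i ] (y i ≡ 0 × z i ≡ 1 ⊎ y i ≡ 1 × z i ≡ 0)

SubIndicator-transfer : ∀ {v w y : Fin n → ℕ} → v ⊆ˢ w → SubIndicator v y → SubIndicator w y
SubIndicator-transfer {w = w} {y} v⊆w y≤v i with w i in wᵢ
... | zero  = proj₁ (y≤v i) , ≤-trans (proj₂ (y≤v i)) (≤-reflexive (v⊆w i wᵢ))
... | suc _ = proj₁ (y≤v i) , ≤-trans (proj₁ (y≤v i)) (s≤s z≤n)

Σ≤suppSize : ∀ {v y : Fin n → ℕ} → SubIndicator v y → Vec.sum (tabulate y) ≤ suppSize v
Σ≤suppSize {zero}          y≤v = z≤n
Σ≤suppSize {suc n} {v} {y} y≤v with v zero | y≤v zero
... | zero  | _ , y₀≤0 = +-mono-≤ y₀≤0 (Σ≤suppSize (y≤v ∘ suc))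
... | suc _ | y₀≤1 , _ = +-mono-≤ y₀≤1 (Σ≤suppSize (y≤v ∘ suc))

subIndicators : (v : Fin n → ℕ) → List (Fin n → ℕ)
subIndicators {zero}  v = [ (λ ()) ]
subIndicators {suc n} v with v zero
... | zero  = List.map (0 VF.∷_) (subIndicators (VF.tail v))
... | suc _ = List.map (0 VF.∷_) S ++ List.map (1 VF.∷_) S
  where S = subIndicators (VF.tail v)

length-subIndicators : ∀ (v : Fin n → ℕ) → length (subIndicators v) ≡ 2 ^ suppSize v
length-subIndicators {zero}  v = refl
length-subIndicators {suc n} v with v zero
... | zero  = trans (length-map (0 VF.∷_) (subIndicators (VF.tail v))) (length-subIndicators (VF.tail v))
... | suc _ = trans (length-map-++-map _ _ S S) (cong₂ _+_ |S|≡2^s (trans |S|≡2^s (sym (+-identityʳ _))))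
  where
  S = subIndicators (VF.tail v)
  |S|≡2^s = length-subIndicators (VF.tail v)

SubIndicator-∷ : ∀ {v : Fin (suc n) → ℕ} {k y} →
                 k ≤ 1 → k ≤ v zero → SubIndicator (VF.tail v) y → SubIndicator v (k VF.∷ y)
SubIndicator-∷ k≤1 k≤v₀ y≤v zero    = k≤1 , k≤v₀
SubIndicator-∷ k≤1 k≤v₀ y≤v (suc i) = y≤v i

subIndicators-sub : ∀ (v : Fin n → ℕ) → All (SubIndicator v) (subIndicators v)
subIndicators-sub {zero}  v = (λ ()) ∷ []
subIndicators-sub {suc n} v with v zero in v₀
... | zero  = AllP.map⁺ (All.map (SubIndicator-∷ z≤n z≤n) (subIndicators-sub (VF.tail v)))
... | suc _ = AllP.++⁺ (AllP.map⁺ (All.map (SubIndicator-∷ z≤n z≤n) rest))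
                       (AllP.map⁺ (All.map (SubIndicator-∷ ≤-refl 1≤v₀) rest))
  where
  rest = subIndicators-sub (VF.tail v)
  1≤v₀ = subst (1 ≤_) (sym v₀) (s≤s z≤n)

Apart-∷ : ∀ {k} {y z : Fin n → ℕ} → Apart y z → Apart (k VF.∷ y) (k VF.∷ z)
Apart-∷ (i , yᵢzᵢ) = suc i , yᵢzᵢ

subIndicators-apart : ∀ (v : Fin n → ℕ) → AllPairs Apart (subIndicators v)
subIndicators-apart {zero}  v = [] ∷ []
subIndicators-apart {suc n} v with v zero
... | zero  = AllPairsP.map⁺ (AllPairs.map Apart-∷ (subIndicators-apart (VF.tail v)))
... | suc _ = AllPairsP.++⁺ (AllPairsP.map⁺ (AllPairs.map Apart-∷ rest))
                            (AllPairsP.map⁺ (AllPairs.map Apart-∷ rest))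
                            (AllP.map⁺ (All.universal (λ _ → AllP.map⁺ (All.universal apart₀ S)) S))
  where
  S = subIndicators (VF.tail v)
  rest = subIndicators-apart (VF.tail v)
  apart₀ : ∀ {y} z → Apart (0 VF.∷ y) (1 VF.∷ z)
  apart₀ _ = zero , inj₁ (refl , refl)

AllPairs-lookup : ∀ {A : Set} {R : A → A → Set} {xs : List A} → AllPairs R xs →
                  ∀ {i j} → i Fin.< j → R (List.lookup xs i) (List.lookup xs j)
AllPairs-lookup (Rx ∷ _)   {zero}  {suc j} _         = All.lookup Rx (∈-lookup j)
AllPairs-lookup (_  ∷ Rxs) {suc i} {suc j} (s≤s i<j) = AllPairs-lookup Rxs i<j

pigeonhole : ∀ {A B : Set} {R : A → A → Set} {xs : List A} {ys : List B} (f : A → B) →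
             AllPairs R xs → (∀ {x} → x ∈ xs → f x ∈ ys) → length ys < length xs →
             ∃₂ λ x x′ → x ∈ xs × x′ ∈ xs × R x x′ × f x ≡ f x′
pigeonhole {xs = xs} {ys} f Rxs f∈ys |ys|<|xs|
  with i , j , i<j , same ← Fin.pigeonhole |ys|<|xs| (λ i → Any.index (f∈ys (∈-lookup i)))
  = List.lookup xs i , List.lookup xs j , ∈-lookup i , ∈-lookup j , AllPairs-lookup Rxs i<j ,
    trans (lookup-index (f∈ys (∈-lookup i)))
          (trans (cong (List.lookup ys) same) (sym (lookup-index (f∈ys (∈-lookup j)))))

tabulate-injective : ∀ {A : Set} {f g : Fin n → A} → tabulate f ≡ tabulate g → f ≗ g
tabulate-injective {f = f} {g} eq i =
  trans (sym (lookup∘tabulate f i)) (trans (cong (λ p → Vec.lookup p i) eq) (lookup∘tabulate g i))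

-- Exchange along a kernel direction of A

dot-+ : ∀ (a : Fin n → ℤ) (x y : Fin n → ℕ) → dot a (λ i → x i + y i) ≡ dot a x ℤ.+ dot a y
dot-+ {zero}  a x y = refl
dot-+ {suc n} a x y = trans
  (cong₂ ℤ._+_ (trans (cong (a zero ℤ.*_) (ℤ.pos-+ (x zero) (y zero))) (ℤ.*-distribˡ-+ (a zero) _ _))
               (dot-+ (a ∘ suc) (x ∘ suc) (y ∘ suc)))
  (interchange (a zero ℤ.* + x zero) (a zero ℤ.* + y zero) _ _)

dot-cong : ∀ (a : Fin n → ℤ) {x y : Fin n → ℕ} → x ≗ y → dot a x ≡ dot a y
dot-cong {zero}  a x≗y = refl
dot-cong {suc n} a x≗y =
  cong₂ (λ x₀ s → a zero ℤ.* + x₀ ℤ.+ s) (x≗y zero) (dot-cong (a ∘ suc) (x≗y ∘ suc))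

ℤ+-cancelʳ-≤ : ∀ k {i j} → i ℤ.+ k ℤ.≤ j ℤ.+ k → i ℤ.≤ j
ℤ+-cancelʳ-≤ k {i} {j} i+k≤j+k =
  subst₂ ℤ._≤_ (//-rightDividesʳ k i) (//-rightDividesʳ k j) (ℤ.+-monoˡ-≤ (ℤ.- k) i+k≤j+k)

shift : (v y z : Fin n → ℕ) → Fin n → ℕ
shift v y z i = v i + y i ∸ z i

module _ {v y z : Fin n → ℕ} where

  shift-+ : SubIndicator v z → ∀ i → shift v y z i + z i ≡ v i + y i
  shift-+ z≤v i = m∸n+n≡m (≤-trans (proj₂ (z≤v i)) (m≤m+n (v i) (y i)))

  shift-⊆ˢ : SubIndicator v y → shift v y z ⊆ˢ v
  shift-⊆ˢ y≤v i vᵢ≡0 = n≤0⇒n≡0 (begin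
    v i + y i ∸ z i ≤⟨ m∸n≤m (v i + y i) (z i) ⟩
    v i + y i       ≤⟨ +-mono-≤ (≤-reflexive vᵢ≡0) (≤-trans (proj₂ (y≤v i)) (≤-reflexive vᵢ≡0)) ⟩
    0               ∎)
    where open ≤-Reasoning

  dot-shift : ∀ (a : Fin n → ℤ) → SubIndicator v z →
              dot a (shift v y z) ℤ.+ dot a z ≡ dot a v ℤ.+ dot a y
  dot-shift a z≤v =
    trans (sym (dot-+ a (shift v y z) z)) (trans (dot-cong a (shift-+ z≤v)) (dot-+ a v y))

module _ {A : Matrix m n} {b : Fin m → ℤ} {c : Fin n → ℤ} where

  shift-feasible : ∀ {v y z} → mulVec A y ≗ mulVec A z → SubIndicator v z →
                   Feasible A b v → Feasible A b (shift v y z)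
  shift-feasible {v} {y} {z} Ay≡Az z≤v Av≡b j = ∙-cancelʳ (mulVec A z j) _ _ (begin
    mulVec A (shift v y z) j ℤ.+ mulVec A z j ≡⟨ dot-shift (A j) z≤v ⟩
    mulVec A v j ℤ.+ mulVec A y j             ≡⟨ cong₂ ℤ._+_ (Av≡b j) (Ay≡Az j) ⟩
    b j ℤ.+ mulVec A z j                      ∎)
    where open ≡-Reasoning

  shift-optimal : ∀ {v y z} → mulVec A y ≗ mulVec A z → SubIndicator v y → SubIndicator v z →
                  Optimal A b c v → Optimal A b c (shift v y z)
  shift-optimal {v} {y} {z} Ay≡Az y≤v z≤v (feasible , optimal) =
    shift-feasible Ay≡Az z≤v feasible , λ x feasibleₓ → ℤ.≤-trans (optimal x feasibleₓ) c·v≤c·w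
    where
    feasible′ : Feasible A b (shift v z y)
    feasible′ = shift-feasible (sym ∘ Ay≡Az) y≤v feasible
    c·v≤c·w : dot c v ℤ.≤ dot c (shift v y z)
    c·v≤c·w = ℤ+-cancelʳ-≤ (dot c z) (begin
      dot c v ℤ.+ dot c z               ≡⟨ dot-shift c y≤v ⟨
      dot c (shift v z y) ℤ.+ dot c y   ≤⟨ ℤ.+-monoˡ-≤ (dot c y) (optimal _ feasible′) ⟩
      dot c v ℤ.+ dot c y               ≡⟨ dot-shift c z≤v ⟨
      dot c (shift v y z) ℤ.+ dot c z   ∎)
      where open ℤ.≤-Reasoning

  exchange : ∀ {v y z} i → mulVec A y ≗ mulVec A z → y i ≡ 0 → z i ≡ 1 →
             Optimal A b c v → SubIndicator v y → SubIndicator v z →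
             ∃[ w ] (Optimal A b c w × suppSize w < suppSize v)
  exchange {v} {y} {z} i Ay≡Az yᵢ≡0 zᵢ≡1 = descend (v i) refl
    where
    descend : ∀ k {v} → v i ≡ k → Optimal A b c v → SubIndicator v y → SubIndicator v z →
              ∃[ w ] (Optimal A b c w × suppSize w < suppSize v)
    descend zero    vᵢ≡0 _ _ z≤v = contradiction (subst₂ _≤_ zᵢ≡1 vᵢ≡0 (proj₂ (z≤v i))) λ ()
    descend (suc k) {v} vᵢ≡1+k optimal y≤v z≤v = case suppSize w <? suppSize v of λ where
        (yes w<v) → w , optimalʷ , w<v
        (no  w≮v) →
          let v⊆w = ⊆ˢ-antisym-suppSize w⊆v w≮v
              (u , optimalᵘ , u<w) = descend k wᵢ≡k optimalʷ
                                       (SubIndicator-transfer v⊆w y≤v) (SubIndicator-transfer v⊆w z≤v)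
          in u , optimalᵘ , <-≤-trans u<w (suppSize-mono w⊆v)
      where
      w = shift v y z
      optimalʷ : Optimal A b c w
      optimalʷ = shift-optimal Ay≡Az y≤v z≤v optimal
      w⊆v : w ⊆ˢ v
      w⊆v = shift-⊆ˢ {z = z} y≤v
      wᵢ≡k : w i ≡ k
      wᵢ≡k = +-cancelʳ-≡ 1 (w i) k (begin
        w i + 1   ≡⟨ cong (λ t → w i + t) zᵢ≡1 ⟨
        w i + z i ≡⟨ shift-+ {y = y} z≤v i ⟩
        v i + y i ≡⟨ cong₂ _+_ vᵢ≡1+k yᵢ≡0 ⟩
        suc k + 0 ≡⟨ +-identityʳ (suc k) ⟩
        suc k     ≡⟨ +-comm 1 k ⟩
        k + 1     ∎)
        where open ≡-Reasoning

-- Optimal solutions of minimal support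

collision : ∀ (A : Matrix m n) v → length (ℓ₁-ball (suppSize v * Amax A) m) < 2 ^ suppSize v →
            ∃₂ λ y z → SubIndicator v y × SubIndicator v z × Apart y z × mulVec A y ≗ mulVec A z
collision {m} A v |ball|<2^s =
  let y , z , y∈ , z∈ , y#z , Ay≡Az =
        pigeonhole (tabulate ∘ mulVec A) (subIndicators-apart v) A*-∈-ball
                   (subst (length ball <_) (sym (length-subIndicators v)) |ball|<2^s)
  in y , z , All.lookup (subIndicators-sub v) y∈ , All.lookup (subIndicators-sub v) z∈ ,
     y#z , tabulate-injective Ay≡Az
  where
  ball = ℓ₁-ball (suppSize v * Amax A) m
  A*-∈-ball : ∀ {y} → y ∈ subIndicators v → tabulate (mulVec A y) ∈ ball
  A*-∈-ball {y} y∈ = ∈-ℓ₁-ball _ (≤-trans (∥A*y∥₁≤Σy*Amax A y)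
                       (*-monoˡ-≤ (Amax A) (Σ≤suppSize (All.lookup (subIndicators-sub v) y∈))))

count-bound : ∀ m s a → 2 ^ s ≤ length (ℓ₁-ball (s * a) m) → 2 ^ s * m ! ≤ (2 * (m + s * a)) ^ m
count-bound m s a 2^s≤|ball| = begin
  2 ^ s * m !                      ≤⟨ *-monoˡ-≤ (m !) 2^s≤|ball| ⟩
  length (ℓ₁-ball (s * a) m) * m ! ≡⟨ *-comm _ (m !) ⟩
  m ! * length (ℓ₁-ball (s * a) m) ≤⟨ ℓ₁-ball-count (s * a) m ⟩
  (2 * (m + s * a)) ^ m            ∎
  where open ≤-Reasoning

bounded-or-reducible : ∀ (A : Matrix m n) b c {v} → Optimal A b c v →
                       SupportBound m (suppSize v) (Amax A) ⊎
                       ∃[ w ] (Optimal A b c w × suppSize w < suppSize v)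
bounded-or-reducible {m} A b c {v} optimal
  with 2 ^ suppSize v ≤? length (ℓ₁-ball (suppSize v * Amax A) m)
... | yes few = inj₁ (SupportBound-intro m (suppSize v) (Amax A) (count-bound m (suppSize v) (Amax A) few))
... | no many with collision A v (≰⇒> many)
...   | y , z , y≤v , z≤v , (i , inj₁ (yᵢ≡0 , zᵢ≡1)) , Ay≡Az =
        inj₂ (exchange {A = A} {b} {c} i Ay≡Az yᵢ≡0 zᵢ≡1 optimal y≤v z≤v)
...   | y , z , y≤v , z≤v , (i , inj₂ (yᵢ≡1 , zᵢ≡0)) , Ay≡Az =
        inj₂ (exchange {A = A} {b} {c} i (sym ∘ Ay≡Az) zᵢ≡0 yᵢ≡1 optimal z≤v y≤v)

descent : ∀ {X : Set} {P Q : X → Set} (μ : X → ℕ) →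
          (∀ {x} → P x → Q x ⊎ ∃[ x′ ] (P x′ × μ x′ < μ x)) →
          ∀ {x} → P x → ∃[ x ] (P x × Q x)
descent {P = P} {Q} μ step {x} Px = go (On.wellFounded μ <-wellFounded x) Px
  where
  go : ∀ {x} → Acc (_<_ on μ) x → P x → ∃[ x ] (P x × Q x)
  go {x} (acc smaller) Px with step Px
  ... | inj₁ Qx              = x , Px , Qx
  ... | inj₂ (x′ , Px′ , x′<x) = go (smaller x′<x) Px′

lemma17 : (m n : ℕ) → .{{_ : NonZero m}} → (A : Matrix m n) → FullRowRank A →
          (b : Fin m → ℤ) → (c : Fin n → ℤ) →
          ∃[ x ] Optimal A b c x →
          ∃[ v ] (Optimal A b c v × SupportBound m (suppSize v) (Amax A))
lemma17 m n A _ b c (x , optimal) = descent suppSize (bounded-or-reducible A b c) optimal
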